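{- Let $G$ be the display graph of a profile $(T_1,\dots,T_k)$ of phylogenetic trees, let $G'$ be a legal triangulation of $G$, and let $(T',B)$ be a clique tree for $G'$. For $w \in V(G)$ let $N(w)$ be the set of nodes $x$ of $T'$ with $w \in B(x)$. Let $e=\{u,v\}$ be an internal edge of the input tree $T_i$ for some $i\in\{1,\dots,k\}$, and let $U(e) = \bigcup_{x \in N(u)\cap N(v)} B(x)$. Then (i) for every $j \in \{1,\dots,k\}$ with $j \neq i$, $U(e)$ contains at most one vertex of $T_j$; and (ii) $V(T_i) \cap U(e) = \{u,v\}$.
   Context: A phylogenetic tree is an unrooted tree whose leaves are in one-to-one correspondence with a set of labels. A profile is a tuple $(T_1,\dots,T_k)$ of phylogenetic trees (label sets may overlap). The display graph $G$ is formed from the disjoint union of $T_1,\dots,T_k$ by identifying leaves having the same label; vertices of $T_j$ are regarded as vertices of $G$ via this identification. A vertex of $G$ obtained by identifying leaves with a common label is a leaf vertex; other vertices are internal. An edge of $G$ is internal if both its endpoints were internal (non-leaf) vertices in its input tree, otherwise non internal. A triangulation of $G$ is a chordal graph $G'$ with $V(G')=V(G)$ and $E(G')\supseteq E(G)$; edges of $E(G')\setminus E(G)$ are fill-in edges. $G'$ is legal if (LT1) any clique of $G'$ containing an internal edge contains no other edge of $G$ (internal or non internal), and (LT2) every fill-in edge has both endpoints internal vertices of $G$. A tree decomposition of a graph $H$ is a pair $(T,B)$ with $T$ a tree and $B$ mapping nodes of $T$ to subsets of $V(H)$ such that every vertex lies in some $B(x)$, every edge is contained in some $B(x)$, and for each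 vertex $w$ the nodes $x$ with $w\in B(x)$ form a subtree. A clique tree of a chordal graph $G'$ is a tree decomposition $(T',B)$ of $G'$ whose nodes are in one-to-one correspondence with the maximal cliques of $G'$, with $B(x)$ equal to the vertex set of the corresponding maximal clique. -}

module Defs where

open import Data.Nat using (ℕ; zero; suc; _≤_)
open import Data.Fin using (Fin; toℕ)
open import Data.Maybe using (Maybe; just)
open import Data.Product using (Σ; ∃; _×_; _,_; proj₁; proj₂)
open import Data.Sum using (_⊎_)
open import Data.Unit using (⊤)
open import Relation.Nullary using (¬_)
open import Relation.Binary.PropositionalEquality using (_≡_)

CycNext : (m : ℕ) → Fin m → Fin m → Set
CycNext m i j = (toℕ j ≡ suc (toℕ i)) ⊎ ((suc (toℕ i) ≡ m) × (toℕ j ≡ 0))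

IsCycle : {A : Set} (_≈_ : A → A → Set) (E : A → A → Set) (m : ℕ) (c : Fin m → A) → Set
IsCycle _≈_ E m c =
  (∀ i j → c i ≈ c j → i ≡ j) × (∀ i j → CycNext m i j → E (c i) (c j))

data ReachIn {A : Set} (E : A → A → Set) (S : A → Set) : A → A → Set where
  here  : ∀ {x} → S x → ReachIn E S x x
  there : ∀ {x y z} → S x → E x y → ReachIn E S y z → ReachIn E S x z

record IsTree (n : ℕ) (Adj : Fin n → Fin n → Set) : Set where
  field
    nonempty  : 1 ≤ n
    adj-sym   : ∀ x y → Adj x y → Adj y x
    adj-irr   : ∀ x → ¬ Adj x x
    connected : ∀ x y → ReachIn Adj (λ _ → ⊤) x y
    acyclic   : ∀ m → 3 ≤ m → (c : Fin m → Fin n) → ¬ IsCycle _≡_ Adj m c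

record PhyloTree : Set₁ where
  field
    n      : ℕ
    Adj    : Fin n → Fin n → Set
    isTree : IsTree n Adj
  IsLeaf : Fin n → Set
  IsLeaf v = ∀ a b → Adj v a → Adj v b → a ≡ b
  field
    label      : Fin n → Maybe ℕ
    label-leaf : ∀ v → IsLeaf v → ∃ λ ℓ → label v ≡ just ℓ
    leaf-label : ∀ v ℓ → label v ≡ just ℓ → IsLeaf v
    label-inj  : ∀ v w ℓ → label v ≡ just ℓ → label w ≡ just ℓ → v ≡ w

-- Its vertex set is the disjoint union of the vertex sets of the trees
-- modulo the equivalence _≈_ identifying leaves with the same label;
-- all notions below respect _≈_ (i.e. they are on the quotient).

module Display {k : ℕ} (T : Fin k → PhyloTree) where

  V : Set
  V = Σ (Fin k) (λ j → Fin (PhyloTree.n (T j)))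

  lab : V → Maybe ℕ
  lab (j , v) = PhyloTree.label (T j) v

  _≈_ : V → V → Set
  a ≈ b = (a ≡ b) ⊎ (∃ λ ℓ → (lab a ≡ just ℓ) × (lab b ≡ just ℓ))

  InTree : Fin k → V → Set
  InTree j w = ∃ λ (v : Fin (PhyloTree.n (T j))) → w ≈ (j , v)

  Internal : V → Set
  Internal (j , v) = ¬ PhyloTree.IsLeaf (T j) v

  EdgeG : V → V → Set
  EdgeG a b = ∃ λ j → ∃ λ v → ∃ λ v' →
    (a ≈ (j , v)) × (b ≈ (j , v')) × PhyloTree.Adj (T j) v v'

  InternalEdgeOf : (i : Fin k) → Fin (PhyloTree.n (T i)) → Fin (PhyloTree.n (T i)) → Set
  InternalEdgeOf i u v = PhyloTree.Adj (T i) u v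
    × ¬ PhyloTree.IsLeaf (T i) u × ¬ PhyloTree.IsLeaf (T i) v

  InternalEdge : V → V → Set
  InternalEdge a b = ∃ λ i → ∃ λ u → ∃ λ v →
    (a ≈ (i , u)) × (b ≈ (i , v)) × InternalEdgeOf i u v

  Respects : (V → Set) → Set
  Respects C = ∀ a b → a ≈ b → C a → C b

  _≐_ : (V → Set) → (V → Set) → Set
  C ≐ D = ∀ a → (C a → D a) × (D a → C a)

  record IsSimpleGraph (E : V → V → Set) : Set where
    field
      resp : ∀ a a' b b' → a ≈ a' → b ≈ b' → E a b → E a' b'
      sym  : ∀ a b → E a b → E b a
      irr  : ∀ a b → a ≈ b → ¬ E a b

  IsClique : (E : V → V → Set) → (V → Set) → Set
  IsClique E C = Respects C × (∀ a b → C a → C b → ¬ (a ≈ b) → E a b)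

  IsMaxClique : (E : V → V → Set) → (V → Set) → Set₁
  IsMaxClique E C = IsClique E C
    × ((C' : V → Set) → IsClique E C' → (∀ a → C a → C' a) → ∀ a → C' a → C a)

  IsChordal : (V → V → Set) → Set
  IsChordal E = ∀ m → 4 ≤ m → (c : Fin m → V) → IsCycle _≈_ E m c →
    ∃ λ i → ∃ λ j → ¬ (i ≡ j) × ¬ CycNext m i j × ¬ CycNext m j i × E (c i) (c j)

  record IsTriangulation (E' : V → V → Set) : Set where
    field
      simple  : IsSimpleGraph E'
      chordal : IsChordal E'
      super   : ∀ a b → EdgeG a b → E' a b

  record IsLegalTriangulation (E' : V → V → Set) : Set₁ where
    field
      triang : IsTriangulation E'
      LT1 : (C : V → Set) → IsClique E' C →
            ∀ a b → InternalEdge a b → C a → C b →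
            ∀ c d → C c → C d → EdgeG c d →
            ((c ≈ a) × (d ≈ b)) ⊎ ((c ≈ b) × (d ≈ a))
      LT2 : ∀ a b → E' a b → ¬ EdgeG a b → Internal a × Internal b

  record IsTreeDecomposition (E : V → V → Set) (m : ℕ)
           (TAdj : Fin m → Fin m → Set) (B : Fin m → V → Set) : Set where
    field
      tree    : IsTree m TAdj
      bagResp : ∀ x → Respects (B x)
      cover   : ∀ a → ∃ λ x → B x a
      edges   : ∀ a b → E a b → ∃ λ x → B x a × B x b
      subtree : ∀ a x y → B x a → B y a → ReachIn TAdj (λ z → B z a) x y

  record IsCliqueTree (E : V → V → Set) (m : ℕ)
           (TAdj : Fin m → Fin m → Set) (B : Fin m → V → Set) : Set₁ where
    field
      treeDec  : IsTreeDecomposition E m TAdj B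
      bagMax   : ∀ x → IsMaxClique E (B x)
      bagOnto  : (C : V → Set) → IsMaxClique E C → ∃ λ x → C ≐ B x
      bagInj   : ∀ x y → B x ≐ B y → x ≡ y

-- The key fact concerns chordal graphs: a vertex x adjacent to both ends of a path
-- w₀ … wₙ with no chord wₜwₜ₊₂ is adjacent to every wₜ (take a chord of the cycle
-- x w₀ … wₙ and recurse on the shorter pieces).  In a legal triangulation, a path of an
-- input tree through internal vertices has no such chord, for it would put the internal
-- edge wₜwₜ₊₁ and the edge wₜ₊₁wₜ₊₂ into one triangle, against LT1.  A vertex of U(e)
-- shares a maximal clique with u and v, so it is adjacent to both and, by LT1 and LT2,
-- is internal unless it is u or v.  Two vertices of U(e) in T_j (j ≠ i) are joined by such
-- a path, seen entirely by u and by v, and then {u, v, w₀, w₁} is a clique violating LT1.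
-- A further vertex of U(e) in T_i is joined by such a path to the end of e it meets
-- first; the other end sees the whole path, and forms with the first end and the vertex
-- before it a triangle violating LT1.

module Submission where

open import Defs
open import Data.Nat using (ℕ; zero; suc; _+_; _∸_; _≤_; _<_; z≤n; s≤s; z<s)
open import Data.Nat.Properties
open import Data.Nat.Induction using (<-rec)
open import Data.Fin using (Fin; toℕ)
open import Data.Fin.Properties using (toℕ-injective; toℕ<n) renaming (_≟_ to _≟ᶠ_)
open import Data.Maybe.Properties using (just-injective)
open import Data.List using ([]; _∷_)
open import Data.List.Relation.Unary.Any using (here; there)
open import Data.List.Relation.Unary.All using ([]; _∷_; lookupAny)
open import Data.List.Relation.Unary.AllPairs using (AllPairs; []; _∷_)
import Data.List.Membership.Setoid as Membership
open import Data.List.Membership.Setoid.Properties using (∈-resp-≈)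
open import Data.Product using (∃; _×_; _,_; proj₁; proj₂)
open import Data.Sum using (_⊎_; inj₁; inj₂; [_,_]; [_,_]′)
import Data.Sum as Sum
open import Data.Empty using (⊥; ⊥-elim)
open import Function using (_∘_)
open import Level using (0ℓ)
open import Relation.Binary.Bundles using (Setoid)
open import Relation.Binary.Definitions using (DecidableEquality; tri<; tri≈; tri>)
open import Relation.Nullary using (¬_; yes; no)
open import Relation.Nullary.Decidable using (_⊎-dec_)
open import Relation.Unary using (Decidable)
open import Relation.Binary.PropositionalEquality
  using (_≡_; _≢_; refl; sym; trans; cong; subst)

least-witness : ∀ {D : ℕ → Set} → Decidable D → ∀ {r} → D r →
                ∃ λ q → q ≤ r × D q × (∀ {t} → t < q → ¬ D t)
least-witness D? {zero} d = 0 , z≤n , d , λ ()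
least-witness D? {suc r} d with D? 0
... | yes d₀ = 0 , z≤n , d₀ , λ ()
... | no ¬d₀ with least-witness (D? ∘ suc) {r} d
...   | q , q≤r , dq , below =
  suc q , s≤s q≤r , dq , λ { {zero} _ → ¬d₀ ; {suc t} (s≤s t<q) → below t<q }

record IsPath {A : Set} (_≈_ E : A → A → Set) (w : ℕ → A) (n : ℕ) : Set where
  field
    distinct : ∀ {p q} → p ≤ n → q ≤ n → w p ≈ w q → p ≡ q
    step     : ∀ {q} → q < n → E (w q) (w (suc q))

NoShortcut : {A : Set} → (A → A → Set) → (ℕ → A) → ℕ → Set
NoShortcut E w n = ∀ {q} → suc q < n → ¬ E (w q) (w (suc (suc q)))

Avoids : {A : Set} → (A → A → Set) → A → (ℕ → A) → ℕ → Set
Avoids _≈_ x w n = ∀ {q} → q ≤ n → ¬ x ≈ w q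

private
  shift : ∀ {o d n q} → o + d ≤ n → q ≤ d → o + q ≤ n
  shift {o} o+d≤n q≤d = ≤-trans (+-monoʳ-≤ o q≤d) o+d≤n

IsPath-drop : ∀ {A : Set} {_≈_ E : A → A → Set} {w n} o {d} → o + d ≤ n →
              IsPath _≈_ E w n → IsPath _≈_ E (λ q → w (o + q)) d
IsPath-drop {E = E} {w} {n} o o+d≤n P = record
  { distinct = λ p≤d q≤d eq →
      +-cancelˡ-≡ o _ _ (distinct (shift o+d≤n p≤d) (shift o+d≤n q≤d) eq)
  ; step     = λ {q} q<d → subst (E (w (o + q)) ∘ w) (sym (+-suc o q))
                             (step (subst (_≤ n) (+-suc o q) (shift o+d≤n q<d)))
  }
  where open IsPath P

NoShortcut-drop : ∀ {A : Set} {E : A → A → Set} {w n} o {d} → o + d ≤ n →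
                  NoShortcut E w n → NoShortcut E (λ q → w (o + q)) d
NoShortcut-drop {E = E} {w} {n} o o+d≤n ns {q} q+1<d =
  subst (λ z → ¬ E (w (o + q)) (w z)) (sym o+2+q≡2+o+q)
    (ns (subst (_≤ n) o+2+q≡2+o+q (shift o+d≤n q+1<d)))
  where
  o+2+q≡2+o+q : o + suc (suc q) ≡ suc (suc (o + q))
  o+2+q≡2+o+q = trans (+-suc o (suc q)) (cong suc (+-suc o q))

Avoids-drop : ∀ {A : Set} {_≈_ : A → A → Set} {x w n} o {d} → o + d ≤ n →
              Avoids _≈_ x w n → Avoids _≈_ x (λ q → w (o + q)) d
Avoids-drop o o+d≤n x∉w q≤d = x∉w (shift o+d≤n q≤d)

_◃_ : {A : Set} → A → (ℕ → A) → ℕ → A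
(x ◃ w) zero    = x
(x ◃ w) (suc q) = w q

IsPath-cons : ∀ {A : Set} {_≈_ E : A → A → Set} → (∀ {a b} → a ≈ b → b ≈ a) →
              ∀ {x w n} → E x (w 0) → Avoids _≈_ x w n →
              IsPath _≈_ E w n → IsPath _≈_ E (x ◃ w) (suc n)
IsPath-cons {_≈_ = _≈_} {E} ≈-sym {x} {w} {n} x~w₀ x∉w P =
  record { distinct = distinct′ ; step = step′ }
  where
  open IsPath P
  distinct′ : ∀ {p q} → p ≤ suc n → q ≤ suc n → (x ◃ w) p ≈ (x ◃ w) q → p ≡ q
  distinct′ {zero}  {zero}  _           _           _  = refl
  distinct′ {zero}  {suc q} _           (s≤s q≤n)   eq = ⊥-elim (x∉w q≤n eq)
  distinct′ {suc p} {zero}  (s≤s p≤n)   _           eq = ⊥-elim (x∉w p≤n (≈-sym eq))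
  distinct′ {suc p} {suc q} (s≤s p≤n)   (s≤s q≤n)   eq = cong suc (distinct p≤n q≤n eq)
  step′ : ∀ {q} → q < suc n → E ((x ◃ w) q) ((x ◃ w) (suc q))
  step′ {zero}  _         = x~w₀
  step′ {suc q} (s≤s q<n) = step q<n

IsPath⇒IsCycle : ∀ {A : Set} {_≈_ E : A → A → Set} {c ℓ} →
                 IsPath _≈_ E c ℓ → E (c ℓ) (c 0) → IsCycle _≈_ E (suc ℓ) (c ∘ toℕ)
IsPath⇒IsCycle {E = E} {c} {ℓ} P closing =
  (λ i j eq → toℕ-injective (distinct (bound i) (bound j) eq)) , edge
  where
  open IsPath P
  bound : (i : Fin (suc ℓ)) → toℕ i ≤ ℓ
  bound i = ≤-pred (toℕ<n i)
  edge : ∀ i j → CycNext (suc ℓ) i j → E (c (toℕ i)) (c (toℕ j))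
  edge i j (inj₁ j≡1+i) =
    subst (E (c (toℕ i)) ∘ c) (sym j≡1+i) (step (subst (_≤ ℓ) j≡1+i (bound j)))
  edge i j (inj₂ (1+i≡1+ℓ , j≡0)) rewrite suc-injective 1+i≡1+ℓ | j≡0 = closing

record Path {A : Set} (E : A → A → Set) (a b : A) : Set where
  field
    len    : ℕ
    vertex : ℕ → A
    start  : vertex 0 ≡ a
    end    : vertex len ≡ b
    isPath : IsPath _≡_ E vertex len

module _ {A : Set} {E : A → A → Set} where

  Path-from : ∀ {a b} (P : Path E a b) {q} → q ≤ Path.len P → Path E (Path.vertex P q) b
  Path-from P {q} q≤len = record
    { len    = len ∸ q
    ; vertex = λ t → vertex (q + t)
    ; start  = cong vertex (+-identityʳ q)
    ; end    = trans (cong vertex (m+[n∸m]≡n q≤len)) end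
    ; isPath = IsPath-drop q (≤-reflexive (m+[n∸m]≡n q≤len)) isPath
    }
    where open Path P

  Path-cons : ∀ {x a b} → E x a → (P : Path E a b) →
              Avoids _≡_ x (Path.vertex P) (Path.len P) → Path E x b
  Path-cons {x} x~a P x∉P = record
    { len    = suc len
    ; vertex = x ◃ vertex
    ; start  = refl
    ; end    = end
    ; isPath = IsPath-cons sym (subst (E x) (sym start) x~a) x∉P isPath
    }
    where open Path P

  walk⇒path : DecidableEquality A → ∀ {S a b} → ReachIn E S a b → Path E a b
  walk⇒path _≟_ {a = a} (here _) = record
    { len = 0 ; vertex = λ _ → a ; start = refl ; end = refl
    ; isPath = record { distinct = λ { z≤n z≤n _ → refl } ; step = λ () }
    }
  walk⇒path _≟_ (there {x} _ x~y rest) with walk⇒path _≟_ rest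
  ... | P with anyUpTo? (λ q → Path.vertex P q ≟ x) (suc (Path.len P))
  ...   | yes (q , q<1+len , vq≡x) =
    subst (λ y → Path E y _) vq≡x (Path-from P (≤-pred q<1+len))
  ...   | no x∉P = Path-cons x~y P (λ q≤len x≡vq → x∉P (_ , s≤s q≤len , sym x≡vq))

module _ (T : PhyloTree) where
  open PhyloTree T

  tree-path : (a b : Fin n) → Path Adj a b
  tree-path a b = walk⇒path _≟ᶠ_ (IsTree.connected isTree a b)

  path-interior-not-leaf : ∀ {p r t} → IsPath _≡_ Adj p r → suc t < r →
                           ¬ IsLeaf (p (suc t))
  path-interior-not-leaf {p} {t = t} P t+1<r leaf =
    m≢1+n+m t {1} (distinct t≤r t+1<r (leaf (p t) (p (suc (suc t)))
                                        (IsTree.adj-sym isTree _ _ (step t<r)) (step t+1<r)))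
    where
    open IsPath P
    t<r = <⇒≤ t+1<r
    t≤r = <⇒≤ t<r

  path-internal : ∀ {p r} → IsPath _≡_ Adj p r → ¬ IsLeaf (p 0) → ¬ IsLeaf (p r) →
                  ∀ {q} → q ≤ r → ¬ IsLeaf (p q)
  path-internal P first last {zero}  _ = first
  path-internal P first last {suc t} t+1≤r with m≤n⇒m<n∨m≡n t+1≤r
  ... | inj₁ t+1<r = path-interior-not-leaf P t+1<r
  ... | inj₂ refl  = last

module _ {k : ℕ} (T : Fin k → PhyloTree) where
  open Display T
  module Tree (j : Fin k) = PhyloTree (T j)

  ≈-refl : ∀ {a} → a ≈ a
  ≈-refl = inj₁ refl

  ≈-sym : ∀ {a b} → a ≈ b → b ≈ a
  ≈-sym (inj₁ refl)        = inj₁ refl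
  ≈-sym (inj₂ (ℓ , la , lb)) = inj₂ (ℓ , lb , la)

  ≈-trans : ∀ {a b c} → a ≈ b → b ≈ c → a ≈ c
  ≈-trans (inj₁ refl) b≈c = b≈c
  ≈-trans (inj₂ a≈b) (inj₁ refl) = inj₂ a≈b
  ≈-trans (inj₂ (ℓ , la , lb)) (inj₂ (ℓ′ , lb′ , lc))
    with just-injective (trans (sym lb) lb′)
  ... | refl = inj₂ (ℓ , la , lc)

  ≈-setoid : Setoid 0ℓ 0ℓ
  ≈-setoid = record
    { Carrier       = V
    ; _≈_           = _≈_
    ; isEquivalence = record { refl = ≈-refl ; sym = ≈-sym ; trans = ≈-trans }
    }

  open Membership ≈-setoid using (_∈_)

  ≈-within-tree : ∀ {j p p′} → (j , p) ≈ (j , p′) → p ≡ p′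
  ≈-within-tree (inj₁ refl)          = refl
  ≈-within-tree {j} (inj₂ (ℓ , lp , lp′)) = Tree.label-inj j _ _ ℓ lp lp′

  internal-≈⇒≡ : ∀ {a j p} → ¬ Tree.IsLeaf j p → a ≈ (j , p) → a ≡ (j , p)
  internal-≈⇒≡ _ (inj₁ a≡jp) = a≡jp
  internal-≈⇒≡ {j = j} {p} internal (inj₂ (ℓ , _ , lp)) =
    ⊥-elim (internal (Tree.leaf-label j p ℓ lp))

  tree-edge : ∀ {j p p′} → Tree.Adj j p p′ → EdgeG (j , p) (j , p′)
  tree-edge {j} {p} {p′} p~p′ = j , p , p′ , ≈-refl , ≈-refl , p~p′

  module Chordal {E′ : V → V → Set} (E′-sym : ∀ {a b} → E′ a b → E′ b a)
                 (chordal : IsChordal E′) where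

    data Chord (x : V) (w : ℕ → V) (n : ℕ) : Set where
      hub-chord  : ∀ {p} → 0 < p → p < n → E′ x (w p) → Chord x w n
      path-chord : ∀ {s t} → suc s < t → t ≤ n → E′ (w s) (w t) → Chord x w n

    module _ {x w n} (P : IsPath _≈_ E′ w n) (x∉w : Avoids _≈_ x w n)
             (x~w₀ : E′ x (w 0)) (x~wₙ : E′ x (w n)) where

      private
        ordered-chord : ∀ {a b} → a < b → b ≤ suc n → b ≢ suc a →
                        ¬ (a ≡ 0 × b ≡ suc n) → E′ ((x ◃ w) a) ((x ◃ w) b) → Chord x w n
        ordered-chord {zero}  {suc zero}    _         _         b≢1 _ _ = ⊥-elim (b≢1 refl)
        ordered-chord {zero}  {suc (suc q)} _         (s≤s q<n) _ not-closing e =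
          hub-chord z<s (≤∧≢⇒< q<n λ q+1≡n → not-closing (refl , cong suc q+1≡n)) e
        ordered-chord {suc s} {suc t}       (s≤s s<t) (s≤s t≤n) b≢ _ e =
          path-chord (≤∧≢⇒< s<t λ s+1≡t → b≢ (cong suc (sym s+1≡t))) t≤n e

      chord-of-cone : 2 ≤ n → Chord x w n
      chord-of-cone 2≤n
        with chordal (2 + n) (+-monoʳ-≤ 2 2≤n) ((x ◃ w) ∘ toℕ)
               (IsPath⇒IsCycle (IsPath-cons ≈-sym x~w₀ x∉w P) (E′-sym x~wₙ))
      ... | i , j , i≢j , ¬i→j , ¬j→i , e with <-cmp (toℕ i) (toℕ j)
      ... | tri< i<j _ _ = ordered-chord i<j (≤-pred (toℕ<n j)) (¬i→j ∘ inj₁)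
                             (λ (i≡0 , j≡1+n) → ¬j→i (inj₂ (cong suc j≡1+n , i≡0))) e
      ... | tri≈ _ i≡j _ = ⊥-elim (i≢j (toℕ-injective i≡j))
      ... | tri> _ _ j<i = ordered-chord j<i (≤-pred (toℕ<n i)) (¬j→i ∘ inj₁)
                             (λ (j≡0 , i≡1+n) → ¬i→j (inj₂ (cong suc i≡1+n , j≡0)))
                             (E′-sym e)

    HubSeesPath : ℕ → Set
    HubSeesPath n = ∀ {x w} → IsPath _≈_ E′ w n → NoShortcut E′ w n → Avoids _≈_ x w n →
                    E′ x (w 0) → E′ x (w n) → ∀ {q} → q ≤ n → E′ x (w q)

    private
      Below : ℕ → Set
      Below n = ∀ {m} → m < n → HubSeesPath m

      split-at-hub-chord : ∀ {n x w p} → Below n →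
        IsPath _≈_ E′ w n → NoShortcut E′ w n → Avoids _≈_ x w n →
        E′ x (w 0) → E′ x (w n) → 0 < p → p < n → E′ x (w p) →
        ∀ {q} → q ≤ n → E′ x (w q)
      split-at-hub-chord {x = x} {w} {p} below P ns x∉w x~w₀ x~wₙ 0<p p<n x~wₚ {q} q≤n =
        [ left , right ]′ (≤-total q p)
        where
        p≤n = <⇒≤ p<n
        p+d≤n = ≤-reflexive (m+[n∸m]≡n p≤n)
        left : q ≤ p → E′ x (w q)
        left = below p<n (IsPath-drop 0 p≤n P) (NoShortcut-drop {E = E′} {w} 0 p≤n ns)
                 (Avoids-drop {_≈_ = _≈_} {x} {w} 0 p≤n x∉w) x~w₀ x~wₚ
        right : p ≤ q → E′ x (w q)
        right p≤q = subst (E′ x ∘ w) (m+[n∸m]≡n p≤q)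
          (below (∸-monoʳ-< 0<p p≤n)
            (IsPath-drop p p+d≤n P) (NoShortcut-drop {E = E′} {w} p p+d≤n ns)
            (Avoids-drop {_≈_ = _≈_} {x} {w} p p+d≤n x∉w)
            (subst (E′ x ∘ w) (sym (+-identityʳ p)) x~wₚ)
            (subst (E′ x ∘ w) (sym (m+[n∸m]≡n p≤n)) x~wₙ)
            (∸-monoˡ-≤ p q≤n))

      -- Recursing with w s as the hub of w (s+1) … w t makes w s adjacent to w (s+2).
      path-chord-forces-shortcut : ∀ {n w s t} → Below n →
        IsPath _≈_ E′ w n → NoShortcut E′ w n → suc s < t → t ≤ n → E′ (w s) (w t) → ⊥
      path-chord-forces-shortcut {w = w} {s} {t} below P ns s+1<t t≤n wₛ~wₜ =
        ns s+1<n (subst (E′ (w s) ∘ w) (cong suc (+-comm s 1)) wₛ~wₛ₊₂)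
        where
        open IsPath P
        s+1≤t = <⇒≤ s+1<t
        s+1<n = <-≤-trans s+1<t t≤n
        d = t ∸ suc s
        1+s+d≡t : suc s + d ≡ t
        1+s+d≡t = m+[n∸m]≡n s+1≤t
        1+s+d≤n = ≤-trans (≤-reflexive 1+s+d≡t) t≤n
        wₛ∉ : Avoids _≈_ (w s) (λ q → w (suc s + q)) d
        wₛ∉ q≤d eq = m≢1+m+n s (distinct (<⇒≤ (<⇒≤ s+1<n))
                                  (≤-trans (+-monoʳ-≤ (suc s) q≤d) 1+s+d≤n) eq)
        wₛ~wₛ₊₂ : E′ (w s) (w (suc s + 1))
        wₛ~wₛ₊₂ =
          below (<-≤-trans (∸-monoʳ-< z<s s+1≤t) t≤n)
            (IsPath-drop (suc s) 1+s+d≤n P)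
            (NoShortcut-drop {E = E′} {w} (suc s) 1+s+d≤n ns) wₛ∉
            (subst (E′ (w s) ∘ w) (sym (+-identityʳ (suc s))) (step (<⇒≤ s+1<n)))
            (subst (E′ (w s) ∘ w) (sym 1+s+d≡t) wₛ~wₜ)
            (m<n⇒0<n∸m s+1<t)

      hub-step : ∀ n → Below n → HubSeesPath n
      hub-step zero          _     _ _  _   x~w₀ _    z≤n       = x~w₀
      hub-step (suc zero)    _     _ _  _   x~w₀ _    z≤n       = x~w₀
      hub-step (suc zero)    _     _ _  _   _    x~w₁ (s≤s z≤n) = x~w₁
      hub-step (suc (suc _)) below P ns x∉w x~w₀ x~wₙ q≤n
        with chord-of-cone P x∉w x~w₀ x~wₙ (s≤s (s≤s z≤n))
      ... | hub-chord 0<p p<n x~wₚ =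
        split-at-hub-chord below P ns x∉w x~w₀ x~wₙ 0<p p<n x~wₚ q≤n
      ... | path-chord s+1<t t≤n wₛ~wₜ =
        ⊥-elim (path-chord-forces-shortcut below P ns s+1<t t≤n wₛ~wₜ)

    hub-adjacent-to-path : ∀ n → HubSeesPath n
    hub-adjacent-to-path = <-rec HubSeesPath hub-step

  module Legal {E′ : V → V → Set} (LT : IsLegalTriangulation E′) where
    open IsLegalTriangulation LT
    open IsTriangulation triang
    open IsSimpleGraph simple using () renaming (resp to E′-resp; sym to E′-sym′)

    E′-sym : ∀ {a b} → E′ a b → E′ b a
    E′-sym {a} {b} = E′-sym′ a b

    open Chordal {E′ = E′} E′-sym chordal using (hub-adjacent-to-path)

    allPairs-adjacent : ∀ {xs a b} → AllPairs E′ xs → a ∈ xs → b ∈ xs → ¬ a ≈ b → E′ a b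
    allPairs-adjacent (_ ∷ _) (here a≈x) (here b≈x) a≉b =
      ⊥-elim (a≉b (≈-trans a≈x (≈-sym b≈x)))
    allPairs-adjacent (x~xs ∷ _) (here a≈x) (there b∈xs) _ with lookupAny x~xs b∈xs
    ... | x~y , b≈y = E′-resp _ _ _ _ (≈-sym a≈x) (≈-sym b≈y) x~y
    allPairs-adjacent (x~xs ∷ _) (there a∈xs) (here b≈x) _ with lookupAny x~xs a∈xs
    ... | x~y , a≈y = E′-sym (E′-resp _ _ _ _ (≈-sym b≈x) (≈-sym a≈y) x~y)
    allPairs-adjacent (_ ∷ ps) (there a∈xs) (there b∈xs) a≉b =
      allPairs-adjacent ps a∈xs b∈xs a≉b

    allPairs⇒clique : ∀ {xs} → AllPairs E′ xs → IsClique E′ (_∈ xs)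
    allPairs⇒clique ps = (λ _ _ → ∈-resp-≈ ≈-setoid) , (λ _ _ → allPairs-adjacent ps)

    internal⇒edge : ∀ {a b} → InternalEdge a b → EdgeG a b
    internal⇒edge (j , p , p′ , a≈ , b≈ , p~p′ , _) = j , p , p′ , a≈ , b≈ , p~p′

    internal-edge-apex : ∀ {a b c} → InternalEdge a b → E′ a c → E′ b c →
                         EdgeG c a ⊎ EdgeG c b → c ≈ a ⊎ c ≈ b
    internal-edge-apex {a} {b} {c} ab a~c b~c =
      [ apex (here ≈-refl) , apex (there (here ≈-refl)) ]
      where
      triangle : AllPairs E′ (a ∷ b ∷ c ∷ [])
      triangle = (super _ _ (internal⇒edge ab) ∷ a~c ∷ []) ∷ (b~c ∷ []) ∷ [] ∷ []
      apex : ∀ {d} → d ∈ (a ∷ b ∷ c ∷ []) → EdgeG c d → c ≈ a ⊎ c ≈ b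
      apex d∈ cd = Sum.map proj₁ proj₁
        (LT1 _ (allPairs⇒clique triangle) a b ab (here ≈-refl) (there (here ≈-refl))
             c _ (there (there (here ≈-refl))) d∈ cd)

    module _ {j : Fin k} {p : ℕ → Fin (Tree.n j)} {r : ℕ}
             (P : IsPath _≡_ (Tree.Adj j) p r)
             (internal : ∀ {q} → q ≤ r → ¬ Tree.IsLeaf j (p q)) where
      open IsPath P

      internal-path-isPath : IsPath _≈_ E′ (λ q → (j , p q)) r
      internal-path-isPath = record
        { distinct = λ p≤r q≤r eq → distinct p≤r q≤r (≈-within-tree eq)
        ; step     = λ q<r → super _ _ (tree-edge (step q<r))
        }

      internal-path-noShortcut : NoShortcut E′ (λ q → (j , p q)) r
      internal-path-noShortcut {q} q+1<r shortcut
        with internal-edge-apex consecutive shortcut (super _ _ (tree-edge (step q+1<r)))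
               (inj₂ (tree-edge (IsTree.adj-sym (Tree.isTree j) _ _ (step q+1<r))))
        where
        q<r = <⇒≤ q+1<r
        consecutive : InternalEdge (j , p q) (j , p (suc q))
        consecutive = j , p q , p (suc q) , ≈-refl , ≈-refl ,
                      step q<r , internal (<⇒≤ q<r) , internal q<r
      ... | inj₁ ≈wq   =
        m≢1+n+m q {1} (sym (distinct q+1<r (<⇒≤ (<⇒≤ q+1<r)) (≈-within-tree ≈wq)))
      ... | inj₂ ≈wq+1 = 1+n≢n (distinct q+1<r (<⇒≤ q+1<r) (≈-within-tree ≈wq+1))

    module EdgeInCliqueTree {m TAdj B} (CT : IsCliqueTree E′ m TAdj B)
                            {i u v} (uv : InternalEdgeOf i u v) where
      open IsCliqueTree CT
      open IsTreeDecomposition treeDec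

      U : V → Set
      U w = ∃ λ x → B x (i , u) × B x (i , v) × B x w

      IsEnd : Fin (Tree.n i) → Set
      IsEnd h = h ≡ u ⊎ h ≡ v

      Ends : Fin (Tree.n i) → Fin (Tree.n i) → Set
      Ends h h′ = (h ≡ u × h′ ≡ v) ⊎ (h ≡ v × h′ ≡ u)

      isEnd? : Decidable IsEnd
      isEnd? h = (h ≟ᶠ u) ⊎-dec (h ≟ᶠ v)

      end-internal : ∀ {h} → IsEnd h → ¬ Tree.IsLeaf i h
      end-internal (inj₁ refl) = proj₁ (proj₂ uv)
      end-internal (inj₂ refl) = proj₂ (proj₂ uv)

      other-end : ∀ {h} → IsEnd h → ∃ (Ends h)
      other-end (inj₁ h≡u) = v , inj₁ (h≡u , refl)
      other-end (inj₂ h≡v) = u , inj₂ (h≡v , refl)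

      Ends⇒IsEnd : ∀ {h h′} → Ends h h′ → IsEnd h′
      Ends⇒IsEnd (inj₁ (_ , h′≡v)) = inj₂ h′≡v
      Ends⇒IsEnd (inj₂ (_ , h′≡u)) = inj₁ h′≡u

      Ends⇒adjacent : ∀ {h h′} → Ends h h′ → Tree.Adj i h h′
      Ends⇒adjacent (inj₁ (refl , refl)) = proj₁ uv
      Ends⇒adjacent (inj₂ (refl , refl)) = IsTree.adj-sym (Tree.isTree i) _ _ (proj₁ uv)

      Ends⇒distinct : ∀ {h h′} → Ends h h′ → h ≢ h′
      Ends⇒distinct ends refl = IsTree.adj-irr (Tree.isTree i) _ (Ends⇒adjacent ends)

      uv-internal : InternalEdge (i , u) (i , v)
      uv-internal = i , u , v , ≈-refl , ≈-refl , uv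

      uv-apex : ∀ {h h′ c} → Ends h h′ → E′ (i , h) c → E′ (i , h′) c → EdgeG c (i , h) →
                c ≈ (i , u) ⊎ c ≈ (i , v)
      uv-apex (inj₁ (refl , refl)) h~c h′~c g =
        internal-edge-apex uv-internal h~c h′~c (inj₁ g)
      uv-apex (inj₂ (refl , refl)) h~c h′~c g =
        internal-edge-apex uv-internal h′~c h~c (inj₂ g)

      U-resp : Respects U
      U-resp a b a≈b (x , Bu , Bv , Ba) = x , Bu , Bv , bagResp x a b a≈b Ba

      U-adjacent : ∀ {a h} → IsEnd h → U a → ¬ a ≈ (i , h) → E′ (i , h) a
      U-adjacent (inj₁ refl) (x , Bu , _ , Ba) a≉h =
        proj₂ (proj₁ (bagMax x)) _ _ Bu Ba (a≉h ∘ ≈-sym)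
      U-adjacent (inj₂ refl) (x , _ , Bv , Ba) a≉h =
        proj₂ (proj₁ (bagMax x)) _ _ Bv Ba (a≉h ∘ ≈-sym)

      U-internal : ∀ {j p} → U (j , p) → ¬ (j , p) ≈ (i , u) → ¬ (j , p) ≈ (i , v) →
                   ¬ Tree.IsLeaf j p
      U-internal Ujp ≉u ≉v = proj₁ (LT2 _ _ (E′-sym u~jp) not-G-edge)
        where
        u~jp = U-adjacent (inj₁ refl) Ujp ≉u
        not-G-edge : ¬ EdgeG _ (i , u)
        not-G-edge g =
          [ ≉u , ≉v ] (uv-apex (inj₁ (refl , refl)) u~jp (U-adjacent (inj₂ refl) Ujp ≉v) g)

      off-edge : ∀ {j x h} → j ≢ i → IsEnd h → ¬ (j , x) ≈ (i , h)
      off-edge j≢i end eq = j≢i (cong proj₁ (internal-≈⇒≡ (end-internal end) eq))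

      ¬two-U-vertices-in-other-tree : ∀ {j a₀ b₀} → j ≢ i → a₀ ≢ b₀ →
                                      U (j , a₀) → U (j , b₀) → ⊥
      ¬two-U-vertices-in-other-tree {j} {a₀} {b₀} j≢i a₀≢b₀ Ua Ub =
        [ off-edge j≢i (inj₁ refl) , off-edge j≢i (inj₂ refl) ] w₀≈end
        where
        open Path (tree-path (T j) a₀ b₀)
        open IsPath isPath
        w : ℕ → V
        w q = (j , vertex q)
        U₀ : U (w 0)
        U₀ = subst (λ z → U (j , z)) (sym start) Ua
        Uₗ : U (w len)
        Uₗ = subst (λ z → U (j , z)) (sym end) Ub
        internal : ∀ {q} → q ≤ len → ¬ Tree.IsLeaf j (vertex q)
        internal = path-internal (T j) isPath
          (U-internal U₀ (off-edge j≢i (inj₁ refl)) (off-edge j≢i (inj₂ refl)))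
          (U-internal Uₗ (off-edge j≢i (inj₁ refl)) (off-edge j≢i (inj₂ refl)))
        1≤len : 1 ≤ len
        1≤len = n≢0⇒n>0 λ len≡0 →
          a₀≢b₀ (trans (sym start) (trans (cong vertex (sym len≡0)) end))
        sees : ∀ {h} → IsEnd h → ∀ {q} → q ≤ len → E′ (i , h) (w q)
        sees end-h = hub-adjacent-to-path len
          (internal-path-isPath isPath internal) (internal-path-noShortcut isPath internal)
          (λ _ h≈w → off-edge j≢i end-h (≈-sym h≈w))
          (U-adjacent end-h U₀ (off-edge j≢i end-h)) (U-adjacent end-h Uₗ (off-edge j≢i end-h))
        clique : AllPairs E′ ((i , u) ∷ (i , v) ∷ w 0 ∷ w 1 ∷ [])
        clique = (super _ _ (tree-edge (proj₁ uv)) ∷ sees (inj₁ refl) z≤n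
                                                  ∷ sees (inj₁ refl) 1≤len ∷ [])
               ∷ (sees (inj₂ refl) z≤n ∷ sees (inj₂ refl) 1≤len ∷ [])
               ∷ (super _ _ (tree-edge (step 1≤len)) ∷ [])
               ∷ [] ∷ []
        w₀≈end : w 0 ≈ (i , u) ⊎ w 0 ≈ (i , v)
        w₀≈end = Sum.map proj₁ proj₁
          (LT1 _ (allPairs⇒clique clique) _ _ uv-internal (here ≈-refl) (there (here ≈-refl))
               _ _ (there (there (here ≈-refl))) (there (there (there (here ≈-refl))))
               (tree-edge (step 1≤len)))

      U-meets-other-tree-once : (j : Fin k) → j ≢ i → ∀ a b → InTree j a → InTree j b →
                                U a → U b → a ≈ b
      U-meets-other-tree-once j j≢i a b (a₀ , a≈) (b₀ , b≈) Ua Ub with a₀ ≟ᶠ b₀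
      ... | yes refl = ≈-trans a≈ (≈-sym b≈)
      ... | no a₀≢b₀ =
        ⊥-elim (¬two-U-vertices-in-other-tree j≢i a₀≢b₀ (U-resp _ _ a≈ Ua) (U-resp _ _ b≈ Ub))

      ¬U-path-to-first-end : ∀ {p q} → IsPath _≡_ (Tree.Adj i) p (suc q) → U (i , p 0) →
                             IsEnd (p (suc q)) → (∀ {t} → t ≤ q → ¬ IsEnd (p t)) → ⊥
      ¬U-path-to-first-end {p} {q} P U₀ last-end not-end with other-end last-end
      ... | h′ , ends = not-end ≤-refl (Sum.map ≈-within-tree ≈-within-tree
                          (uv-apex ends h~wq h′~wq (tree-edge (step ≤-refl))))
        where
        open IsPath P
        w : ℕ → V
        w t = (i , p t)
        ≉end : ∀ {t h} → t ≤ q → IsEnd h → ¬ w t ≈ (i , h)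
        ≉end t≤q end-h wt≈h = not-end t≤q (subst IsEnd (sym (≈-within-tree wt≈h)) end-h)
        internal : ∀ {t} → t ≤ suc q → ¬ Tree.IsLeaf i (p t)
        internal = path-internal (T i) P
          (U-internal U₀ (≉end z≤n (inj₁ refl)) (≉end z≤n (inj₂ refl))) (end-internal last-end)
        h′∉w : Avoids _≈_ (i , h′) w (suc q)
        h′∉w t≤1+q with m≤n⇒m<n∨m≡n t≤1+q
        ... | inj₁ t<1+q = ≉end (≤-pred t<1+q) (Ends⇒IsEnd ends) ∘ ≈-sym
        ... | inj₂ refl  = Ends⇒distinct ends ∘ sym ∘ ≈-within-tree
        h~wq : E′ (i , p (suc q)) (w q)
        h~wq = E′-sym (super _ _ (tree-edge (step ≤-refl)))
        h′~wq : E′ (i , h′) (w q)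
        h′~wq = hub-adjacent-to-path (suc q)
          (internal-path-isPath P internal) (internal-path-noShortcut P internal) h′∉w
          (U-adjacent (Ends⇒IsEnd ends) U₀ (≉end z≤n (Ends⇒IsEnd ends)))
          (E′-sym (super _ _ (tree-edge (Ends⇒adjacent ends))))
          (n≤1+n q)

      U-misses-rest-of-Tᵢ : ∀ {a₀} → ¬ IsEnd a₀ → U (i , a₀) → ⊥
      U-misses-rest-of-Tᵢ {a₀} a₀∉uv Ua = path-to-u (tree-path (T i) a₀ u)
        where
        path-to-u : Path (Tree.Adj i) a₀ u → ⊥
        path-to-u P with least-witness (isEnd? ∘ vertex) (subst IsEnd (sym end) (inj₁ refl))
          where open Path P
        ... | zero  , _ , end₀ , _ = a₀∉uv (subst IsEnd (Path.start P) end₀)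
        ... | suc q , q+1≤len , end-q+1 , before =
          ¬U-path-to-first-end (IsPath-drop 0 q+1≤len (Path.isPath P))
            (subst (λ z → U (i , z)) (sym (Path.start P)) Ua) end-q+1 (λ t≤q → before (s≤s t≤q))

      U∩Tᵢ⊆uv : ∀ a → InTree i a × U a → a ≈ (i , u) ⊎ a ≈ (i , v)
      U∩Tᵢ⊆uv a ((a₀ , a≈) , Ua) with isEnd? a₀
      ... | yes (inj₁ refl) = inj₁ a≈
      ... | yes (inj₂ refl) = inj₂ a≈
      ... | no a₀∉uv        = ⊥-elim (U-misses-rest-of-Tᵢ a₀∉uv (U-resp _ _ a≈ Ua))

      uv⊆U∩Tᵢ : ∀ a → a ≈ (i , u) ⊎ a ≈ (i , v) → InTree i a × U a
      uv⊆U∩Tᵢ a a≈uv with edges _ _ (super _ _ (tree-edge (proj₁ uv)))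
      ... | x , Bu , Bv =
        [ (u ,_) , (v ,_) ]′ a≈uv ,
        x , Bu , Bv , [ (λ a≈u → bagResp x _ a (≈-sym a≈u) Bu)
                      , (λ a≈v → bagResp x _ a (≈-sym a≈v) Bv) ]′ a≈uv

lemma4p4 : {k : ℕ} (T : Fin k → PhyloTree) →
  let open Display T in
  (E' : V → V → Set) → IsLegalTriangulation E' →
  (m : ℕ) (TAdj : Fin m → Fin m → Set) (B : Fin m → V → Set) →
  IsCliqueTree E' m TAdj B →
  (i : Fin k) (u v : Fin (PhyloTree.n (T i))) → InternalEdgeOf i u v →
  let U : V → Set
      U w = ∃ λ x → B x (i , u) × B x (i , v) × B x w
  in
  ((j : Fin k) → ¬ (j ≡ i) → ∀ a b → InTree j a → InTree j b → U a → U b → a ≈ b)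
  × (∀ a → ((InTree i a × U a) → ((a ≈ (i , u)) ⊎ (a ≈ (i , v))))
         × (((a ≈ (i , u)) ⊎ (a ≈ (i , v))) → (InTree i a × U a)))
lemma4p4 T E′ LT m TAdj B CT i u v uv =
  U-meets-other-tree-once , λ a → U∩Tᵢ⊆uv a , uv⊆U∩Tᵢ a
  where
  open Legal T LT
  open EdgeInCliqueTree CT uv
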